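{- Let $\alpha,\beta\in\{\mathbf{0},\mathbf{1}\}^*$ with $\alpha\neq\beta$. Then $B^-\vdash\overline{\alpha}\neq\overline{\beta}$.
   Context: Bit strings are elements of $\{\mathbf{0},\mathbf{1}\}^*$; $\varepsilon$ is the empty string. The language $\mathcal{L}^-_{BT}$ has constant symbols $e,0,1$ and a binary function symbol $\circ$ (also written as juxtaposition). Biterals: $\overline{\varepsilon}=e$, $\overline{\alpha\mathbf{0}}=\overline{\alpha}\circ 0$, $\overline{\alpha\mathbf{1}}=\overline{\alpha}\circ 1$. The theory $B^-$ has the four axioms: (1) $\forall x[x=ex\wedge x=xe]$; (2) $\forall xyz[(xy)z=x(yz)]$; (3) $\forall xy[x\neq y\to(x0\neq y0\wedge x1\neq y1)]$; (4) $\forall xy[x0\neq y1]$. -}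

module Defs where

open import Data.Nat using (ℕ; zero; suc)
open import Data.List using (List; foldl)

data Bit : Set where
  𝟎 𝟏 : Bit

BitString : Set
BitString = List Bit

-- The language L⁻_BT: constants e, 0, 1 and binary ∘ ; variables are
-- de Bruijn indices.

infixl 7 _∘'_
data Term : Set where
  var : ℕ → Term
  e   : Term
  c0  : Term
  c1  : Term
  _∘'_ : Term → Term → Term

infix  6 _≐_
infixr 4 _⇒_
data Formula : Set where
  _≐_ : Term → Term → Formula
  ⊥'  : Formula
  _⇒_ : Formula → Formula → Formula
  ∀'  : Formula → Formula

¬' : Formula → Formula
¬' φ = φ ⇒ ⊥'

infixr 5 _∧'_
_∧'_ : Formula → Formula → Formula
φ ∧' ψ = ¬' (φ ⇒ ¬' ψ)

renT : (ℕ → ℕ) → Term → Term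
renT ρ (var n)  = var (ρ n)
renT ρ e        = e
renT ρ c0       = c0
renT ρ c1       = c1
renT ρ (s ∘' t) = renT ρ s ∘' renT ρ t

substT : (ℕ → Term) → Term → Term
substT σ (var n)  = σ n
substT σ e        = e
substT σ c0       = c0
substT σ c1       = c1
substT σ (s ∘' t) = substT σ s ∘' substT σ t

exts : (ℕ → Term) → ℕ → Term
exts σ zero    = var zero
exts σ (suc n) = renT suc (σ n)

substF : (ℕ → Term) → Formula → Formula
substF σ (s ≐ t) = substT σ s ≐ substT σ t
substF σ ⊥'      = ⊥'
substF σ (φ ⇒ ψ) = substF σ φ ⇒ substF σ ψ
substF σ (∀' φ)  = ∀' (substF (exts σ) φ)

-- weakening: φ viewed under one more binder (index 0 not free)
shiftF : Formula → Formula
shiftF = substF (λ n → var (suc n))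

single : Term → ℕ → Term
single t zero    = t
single t (suc n) = var n

inst : Term → Formula → Formula
inst t = substF (single t)

-- Hilbert-style classical first-order proof system with equality,
-- relative to a set of (closed) non-logical axioms Γ.

infix 2 _⊢_
data _⊢_ (Γ : Formula → Set) : Formula → Set where
  hyp : ∀ {φ} → Γ φ → Γ ⊢ φ
  ax-K : ∀ {φ ψ} → Γ ⊢ φ ⇒ ψ ⇒ φ
  ax-S : ∀ {φ ψ χ} → Γ ⊢ (φ ⇒ ψ ⇒ χ) ⇒ (φ ⇒ ψ) ⇒ φ ⇒ χ
  ax-DN : ∀ {φ} → Γ ⊢ ¬' (¬' φ) ⇒ φ
  ax-∀E : ∀ {φ} (t : Term) → Γ ⊢ ∀' φ ⇒ inst t φ
  ax-∀I : ∀ {φ ψ} → Γ ⊢ ∀' (shiftF φ ⇒ ψ) ⇒ φ ⇒ ∀' ψ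
  ax-refl : ∀ (t : Term) → Γ ⊢ t ≐ t
  ax-leib : ∀ {s t} (φ : Formula) → Γ ⊢ s ≐ t ⇒ inst s φ ⇒ inst t φ
  mp : ∀ {φ ψ} → Γ ⊢ φ ⇒ ψ → Γ ⊢ φ → Γ ⊢ ψ
  gen : ∀ {φ} → Γ ⊢ φ → Γ ⊢ ∀' φ

-- The theory B⁻  (∀x y z written with de Bruijn: x = var 2, y = var 1, z = var 0)

data B⁻ : Formula → Set where
  B1 : B⁻ (∀' ((var 0 ≐ e ∘' var 0) ∧' (var 0 ≐ var 0 ∘' e)))
  B2 : B⁻ (∀' (∀' (∀' ((var 2 ∘' var 1) ∘' var 0 ≐ var 2 ∘' (var 1 ∘' var 0)))))
  B3 : B⁻ (∀' (∀' (¬' (var 1 ≐ var 0) ⇒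
                     (¬' (var 1 ∘' c0 ≐ var 0 ∘' c0) ∧' ¬' (var 1 ∘' c1 ≐ var 0 ∘' c1)))))
  B4 : B⁻ (∀' (∀' (¬' (var 1 ∘' c0 ≐ var 0 ∘' c1))))

-- Biterals: ε̄ = e, ᾱ𝟎 = ᾱ ∘ 0, ᾱ𝟏 = ᾱ ∘ 1

bitConst : Bit → Term
bitConst 𝟎 = c0
bitConst 𝟏 = c1

biteral : BitString → Term
biteral = foldl (λ t b → t ∘' bitConst b) e

-- Read a biteral from its last bit. Two biterals ending in the same bit are
-- separated by axiom 3 once their prefixes are, and biterals ending in
-- different bits by axiom 4. The empty biteral e is separated from t ∘ b by
-- multiplying on the left with w = e ∘ b′ for the other bit b′: axioms 1 and 2
-- turn e = t ∘ b into w = (w ∘ t) ∘ b, which axiom 4 refutes.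
module Submission where

open import Defs
open import Data.Empty using (⊥-elim)
open import Data.Nat using (suc)
open import Data.List using ([]; _∷_; _∷ʳ_; foldl)
open import Data.List.Properties using (foldl-∷ʳ)
open import Data.List.Reverse using (Reverse; []; _∶_∶ʳ_; reverseView)
open import Function using (_∘_)
open import Relation.Binary.PropositionalEquality
  using (_≡_; _≢_; refl; sym; trans; cong; cong₂; subst; subst₂; module ≡-Reasoning)

variable
  Γ : Formula → Set
  φ ψ χ : Formula
  s t u : Term

infixr 9 _∙_

_∙_ : Γ ⊢ φ ⇒ ψ → Γ ⊢ ψ ⇒ χ → Γ ⊢ φ ⇒ χ
p ∙ q = mp (mp ax-S (mp ax-K q)) p

mp-under : Γ ⊢ φ ⇒ ψ ⇒ χ → Γ ⊢ ψ → Γ ⊢ φ ⇒ χ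
mp-under h p = mp (mp ax-S h) (mp ax-K p)

⇒-compose : Γ ⊢ (ψ ⇒ χ) ⇒ (φ ⇒ ψ) ⇒ φ ⇒ χ
⇒-compose = ax-K ∙ ax-S

⇒-contravariant : Γ ⊢ φ ⇒ ψ → Γ ⊢ (ψ ⇒ χ) ⇒ (φ ⇒ χ)
⇒-contravariant = mp-under ⇒-compose

ex-falso : Γ ⊢ ⊥' ⇒ φ
ex-falso = ax-K ∙ ax-DN

∧-proj₁ : Γ ⊢ φ ∧' ψ ⇒ φ
∧-proj₁ = ⇒-contravariant (mp ⇒-compose ex-falso) ∙ ax-DN

∧-proj₂ : Γ ⊢ φ ∧' ψ ⇒ ψ
∧-proj₂ = ⇒-contravariant ax-K ∙ ax-DN

data Closed : Term → Set where
  e    : Closed e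
  c0   : Closed c0
  c1   : Closed c1
  _∘ᶜ_ : Closed s → Closed t → Closed (s ∘' t)

renT-closed : ∀ ρ → Closed t → renT ρ t ≡ t
renT-closed ρ e        = refl
renT-closed ρ c0       = refl
renT-closed ρ c1       = refl
renT-closed ρ (s ∘ᶜ t) = cong₂ _∘'_ (renT-closed ρ s) (renT-closed ρ t)

substT-closed : ∀ σ → Closed t → substT σ t ≡ t
substT-closed σ e        = refl
substT-closed σ c0       = refl
substT-closed σ c1       = refl
substT-closed σ (s ∘ᶜ t) = cong₂ _∘'_ (substT-closed σ s) (substT-closed σ t)

inst-shifted-closed : Closed s → substT (single t) (renT suc s) ≡ s
inst-shifted-closed cs = trans (cong (substT _) (renT-closed suc cs)) (substT-closed _ cs)

cast : φ ≡ ψ → Γ ⊢ φ → Γ ⊢ ψ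
cast {Γ = Γ} = subst (Γ ⊢_)

≐-sym : Closed s → Γ ⊢ s ≐ t ⇒ t ≐ s
≐-sym {s = s} {t = t} cs = mp-under
  (cast (cong₂ (λ a b → s ≐ t ⇒ s ≐ a ⇒ t ≐ b) (substT-closed _ cs) (substT-closed _ cs))
        (ax-leib {s = s} {t = t} (var 0 ≐ s)))
  (ax-refl s)

≐-trans : Closed s → Γ ⊢ t ≐ u ⇒ s ≐ t ⇒ s ≐ u
≐-trans {s = s} {t = t} {u = u} cs =
  cast (cong₂ (λ a b → t ≐ u ⇒ a ≐ t ⇒ b ≐ u) (substT-closed _ cs) (substT-closed _ cs))
       (ax-leib {s = t} {t = u} (s ≐ var 0))

∘-congˡ : Closed u → Closed s → Γ ⊢ s ≐ t ⇒ u ∘' s ≐ u ∘' t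
∘-congˡ {u = u} {s = s} {t = t} cu cs =
  mp-under (cast instances (ax-leib {s = s} {t = t} (u ∘' s ≐ u ∘' var 0))) (ax-refl (u ∘' s))
  where
  instances : (s ≐ t ⇒ inst s (u ∘' s ≐ u ∘' var 0) ⇒ inst t (u ∘' s ≐ u ∘' var 0))
            ≡ (s ≐ t ⇒ u ∘' s ≐ u ∘' s ⇒ u ∘' s ≐ u ∘' t)
  instances rewrite substT-closed (single s) cu | substT-closed (single s) cs
                  | substT-closed (single t) cu | substT-closed (single t) cs = refl

infix 4 _≉_

_≉_ : Term → Term → Set
s ≉ t = B⁻ ⊢ ¬' (s ≐ t)

≉-sym : Closed s → Closed t → s ≉ t → t ≉ s
≉-sym cs ct s≉t = ≐-sym ct ∙ s≉t

∘-identityʳ : ∀ u → B⁻ ⊢ u ≐ u ∘' e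
∘-identityʳ u = mp ∧-proj₂ (mp (ax-∀E u) (hyp B1))

∘-assoc : Closed s → Closed t → Closed u → B⁻ ⊢ (s ∘' t) ∘' u ≐ s ∘' (t ∘' u)
∘-assoc {s = s} {t = t} {u = u} cs ct cu =
  cast (cong₂ (λ a b → (a ∘' b) ∘' u ≐ a ∘' (b ∘' u)) s-instance (inst-shifted-closed ct))
       (mp (ax-∀E u) (mp (ax-∀E t) (mp (ax-∀E s) (hyp B2))))
  where
  s-instance : substT (single u) (substT (exts (single t)) (renT suc (renT suc s))) ≡ s
  s-instance = begin
    substT (single u) (substT (exts (single t)) (renT suc (renT suc s)))
      ≡⟨ cong (substT _ ∘ substT _)
              (trans (cong (renT suc) (renT-closed suc cs)) (renT-closed suc cs)) ⟩
    substT (single u) (substT (exts (single t)) s)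
      ≡⟨ cong (substT _) (substT-closed _ cs) ⟩
    substT (single u) s
      ≡⟨ substT-closed _ cs ⟩
    s ∎
    where open ≡-Reasoning

∘-cancelʳ : Closed s →
            B⁻ ⊢ ¬' (s ≐ t) ⇒ (¬' (s ∘' c0 ≐ t ∘' c0) ∧' ¬' (s ∘' c1 ≐ t ∘' c1))
∘-cancelʳ {s = s} {t = t} cs =
  cast (cong (λ a → ¬' (a ≐ t) ⇒ (¬' (a ∘' c0 ≐ t ∘' c0) ∧' ¬' (a ∘' c1 ≐ t ∘' c1)))
             (inst-shifted-closed cs))
       (mp (ax-∀E t) (mp (ax-∀E s) (hyp B3)))

∘0≉∘1 : Closed s → s ∘' c0 ≉ t ∘' c1
∘0≉∘1 {s = s} {t = t} cs =
  cast (cong (λ a → ¬' (a ∘' c0 ≐ t ∘' c1)) (inst-shifted-closed cs))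
       (mp (ax-∀E t) (mp (ax-∀E s) (hyp B4)))

bitConst-closed : ∀ b → Closed (bitConst b)
bitConst-closed 𝟎 = c0
bitConst-closed 𝟏 = c1

∘-bit-≉ : ∀ a b → Closed s → Closed t → (a ≡ b → s ≉ t) →
          s ∘' bitConst a ≉ t ∘' bitConst b
∘-bit-≉ 𝟎 𝟎 cs ct s≉t = mp ∧-proj₁ (mp (∘-cancelʳ cs) (s≉t refl))
∘-bit-≉ 𝟏 𝟏 cs ct s≉t = mp ∧-proj₂ (mp (∘-cancelʳ cs) (s≉t refl))
∘-bit-≉ 𝟎 𝟏 cs ct _   = ∘0≉∘1 cs
∘-bit-≉ 𝟏 𝟎 cs ct _   = ≉-sym (ct ∘ᶜ c0) (cs ∘ᶜ c1) (∘0≉∘1 ct)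

flip : Bit → Bit
flip 𝟎 = 𝟏
flip 𝟏 = 𝟎

flip-≢ : ∀ b → flip b ≢ b
flip-≢ 𝟎 ()
flip-≢ 𝟏 ()

e≉∘-bit : ∀ b → Closed t → e ≉ t ∘' bitConst b
e≉∘-bit {t = t} b ct = e≐tb⇒w≐wtb ∙ ∘-bit-≉ (flip b) b e (cw ∘ᶜ ct) (⊥-elim ∘ flip-≢ b)
  where
  w : Term
  w = e ∘' bitConst (flip b)

  cw : Closed w
  cw = e ∘ᶜ bitConst-closed (flip b)

  cb : Closed (bitConst b)
  cb = bitConst-closed b

  e≐tb⇒w≐wtb : B⁻ ⊢ e ≐ t ∘' bitConst b ⇒ w ≐ (w ∘' t) ∘' bitConst b
  e≐tb⇒w≐wtb = ∘-congˡ cw e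
              ∙ mp-under (≐-trans cw) (∘-identityʳ w)
              ∙ mp (≐-trans cw) (mp (≐-sym ((cw ∘ᶜ ct) ∘ᶜ cb)) (∘-assoc cw ct cb))

biteral-∷ʳ : ∀ α b → biteral (α ∷ʳ b) ≡ biteral α ∘' bitConst b
biteral-∷ʳ α b = foldl-∷ʳ _ e b α

foldl-bits-closed : ∀ α → Closed t → Closed (foldl (λ t b → t ∘' bitConst b) t α)
foldl-bits-closed []      ct = ct
foldl-bits-closed (b ∷ α) ct = foldl-bits-closed α (ct ∘ᶜ bitConst-closed b)

biteral-closed : ∀ α → Closed (biteral α)
biteral-closed α = foldl-bits-closed α e

biterals-≉ : ∀ {α β} → Reverse α → Reverse β → α ≢ β → biteral α ≉ biteral β
biterals-≉ [] [] α≢β = ⊥-elim (α≢β refl)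
biterals-≉ [] (β ∶ _ ∶ʳ b) _ =
  subst (e ≉_) (sym (biteral-∷ʳ β b)) (e≉∘-bit b (biteral-closed β))
biterals-≉ (α ∶ _ ∶ʳ a) [] _ =
  subst (_≉ e) (sym (biteral-∷ʳ α a))
        (≉-sym e (biteral-closed α ∘ᶜ bitConst-closed a) (e≉∘-bit a (biteral-closed α)))
biterals-≉ (α ∶ rα ∶ʳ a) (β ∶ rβ ∶ʳ b) αa≢βb =
  subst₂ _≉_ (sym (biteral-∷ʳ α a)) (sym (biteral-∷ʳ β b))
         (∘-bit-≉ a b (biteral-closed α) (biteral-closed β)
                  λ { refl → biterals-≉ rα rβ (αa≢βb ∘ cong (_∷ʳ a)) })

lemma4 : (α β : BitString) → α ≢ β → B⁻ ⊢ ¬' (biteral α ≐ biteral β)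
lemma4 α β = biterals-≉ (reverseView α) (reverseView β)
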